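{- Let $\mathfrak{C}$ be a verification-condition provider and $\mathcal{T}\in\{\mathrm{dwp},\mathrm{awp}\}$. If for every annotated loop $C=\mathtt{while}_I(\varphi)\{C'\}$ and every expectation $f$, $\mathrm{vc}^{\mathfrak{C}}_{\mathcal{T}}[\![C]\!](f)$ implies $\mathcal{T}[\![C]\!](f)\preceq I$, then $\mathfrak{C}$ yields upper bounds for $\mathcal{T}$. Analogously, if for every annotated loop $C=\mathtt{while}_I(\varphi)\{C'\}$ and every expectation $f$, $\mathrm{vc}^{\mathfrak{C}}_{\mathcal{T}}[\![C]\!](f)$ implies $\mathcal{T}[\![C]\!](f)\succeq I$, then $\mathfrak{C}$ yields lower bounds for $\mathcal{T}$.
   Context: States: fix a countably infinite set $\mathsf{Vars}$ of variables with values in $\mathbb{Q}_{\ge 0}$; $\mathsf{States}$ is the set of maps $\sigma:\mathsf{Vars}\to\mathbb{Q}_{\ge0}$ that are $0$ for all but finitely many variables. Predicates are maps $\mathsf{States}\to\{\mathsf{true},\mathsf{false}\}$. pGCL programs: $\mathtt{skip}$; $x:=E$ ($E:\mathsf{States}\to\mathbb{Q}_{\ge0}$); $C_1;C_2$; $\mathtt{if}\ \varphi_1\to C_1\ \square\ \varphi_2\to C_2$ with $\varphi_1\vee\varphi_2$ valid; $\{C_1\}[p]\{C_2\}$ with $p:\mathsf{States}\to[0,1]$; loops $\mathtt{while}_I(\varphi)\{C\}$ annotated with an invariant expectation $I$. Expectations: maps $\mathsf{States}\to[0,\infty]$ with pointwise order $\preceq$/$\succeq$; pointwise arithmetic ($0\cdot\infty=0$),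 $\sqcap,\sqcup$ pointwise min/max; $[\varphi]$ Iverson bracket; $(\varphi\to g)(\sigma)=g(\sigma)$ if $\sigma\models\varphi$ else $\infty$; $f[x/E](\sigma)=f(\sigma[x\mapsto E(\sigma)])$. For $\mathcal{T}\in\{\mathrm{dwp},\mathrm{awp}\}$: $\mathcal{T}[\![\mathtt{skip}]\!](f)=f$; $\mathcal{T}[\![x:=E]\!](f)=f[x/E]$; $\mathcal{T}[\![C_1;C_2]\!](f)=\mathcal{T}[\![C_1]\!](\mathcal{T}[\![C_2]\!](f))$; $\mathcal{T}[\![\{C_1\}[p]\{C_2\}]\!](f)=p\cdot\mathcal{T}[\![C_1]\!](f)+(1-p)\cdot\mathcal{T}[\![C_2]\!](f)$; $\mathrm{dwp}$ of guarded choice $=(\varphi_1\to\mathrm{dwp}[\![C_1]\!](f))\sqcap(\varphi_2\to\mathrm{dwp}[\![C_2]\!](f))$, $\mathrm{awp}$ of it $=[\varphi_1]\cdot\mathrm{awp}[\![C_1]\!](f)\sqcup[\varphi_2]\cdot\mathrm{awp}[\![C_2]\!](f)$; loop: $\mathrm{lfp}\,g.\,[\neg\varphi]\cdot f+[\varphi]\cdot\mathcal{T}[\![C']\!](g)$. The auxiliary $\mathcal{T}^*$ has the same clauses (recursively with $\mathcal{T}^*$) except $\mathcal{T}^*[\![\mathtt{while}_I(\varphi)\{C'\}]\!](f)=I$. A verification-condition provider $\mathfrak{C}$ maps pairs (annotated loop, expectation) to $\{\mathsf{true},\mathsf{false}\}$. $\mathrm{vc}^{\mathfrak{C}}_{\mathcal{T}}[\![C]\!](f)$: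 $\mathsf{true}$ for $\mathtt{skip}$/assignments; $\mathrm{vc}[\![C_1]\!](\mathcal{T}^*[\![C_2]\!](f))\wedge\mathrm{vc}[\![C_2]\!](f)$ for $C_1;C_2$; $\mathrm{vc}[\![C_1]\!](f)\wedge\mathrm{vc}[\![C_2]\!](f)$ for guarded and probabilistic choice; $\mathfrak{C}(C,f)\wedge\mathrm{vc}[\![C']\!](I)$ for $C=\mathtt{while}_I(\varphi)\{C'\}$. $\mathfrak{C}$ yields upper bounds for $\mathcal{T}$ if for all pGCL programs $C$ and expectations $f$, $\mathrm{vc}^{\mathfrak{C}}_{\mathcal{T}}[\![C]\!](f)$ implies $\mathcal{T}[\![C]\!](f)\preceq\mathcal{T}^*[\![C]\!](f)$; it yields lower bounds if the same implication holds with $\succeq$. -}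

module Defs where

open import Level using (0ℓ)
open import Data.Nat as ℕ using (ℕ; zero; suc; _≟_)
import Data.Nat.Properties as ℕP
open import Data.Bool using (Bool; true; false; if_then_else_; _∧_; _∨_; not)
open import Data.Unit using (⊤; tt)
open import Data.Empty using (⊥)
open import Data.Product using (Σ; ∃; ∃-syntax; _×_; _,_; proj₁; proj₂)
open import Data.Sum using (_⊎_; inj₁; inj₂)
open import Data.Rational using (ℚ; 0ℚ; 1ℚ; _<_; _≤_; _+_; _-_; _*_; _<?_; _≤?_; _⊓_)
open import Data.Rational.Properties
  using (<-dense; <-trans; ≤-<-trans; <-≤-trans; ≤-refl; +-mono-≤-<; +-identityʳ; p⊓q≤p; p⊓q≤q; p≤q⇒p⊓q≡p; p≥q⇒p⊓q≡q; <⇒≤; ≰⇒>)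
open import Relation.Nullary using (yes; no; ¬_)
open import Relation.Nullary.Decidable using (toWitness)
open import Relation.Binary.PropositionalEquality using (_≡_; refl; subst; sym)

ℚ≥0 : Set
ℚ≥0 = Σ ℚ (λ q → 0ℚ ≤ q)

Var : Set
Var = ℕ

FinSupp : (ℕ → ℚ≥0) → Set
FinSupp σ = ∃[ n ] (∀ m → n ℕ.≤ m → proj₁ (σ m) ≡ 0ℚ)

State : Set
State = Σ (ℕ → ℚ≥0) FinSupp

update : State → Var → ℚ≥0 → State
update (σ , n , fin) x v = σ' , suc x ℕ.⊔ n , fin'
  where
  σ' : ℕ → ℚ≥0
  σ' m with m ≟ x
  ... | yes _ = v
  ... | no _  = σ m
  fin' : ∀ m → suc x ℕ.⊔ n ℕ.≤ m → proj₁ (σ' m) ≡ 0ℚ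
  fin' m le with m ≟ x
  ... | yes refl = Data.Empty.⊥-elim
                     (ℕP.<-irrefl refl (ℕP.≤-trans (ℕP.m≤m⊔n (suc x) n) le))
    where import Data.Empty
  ... | no _ = fin m (ℕP.≤-trans (ℕP.m≤n⊔m (suc x) n) le)

Pred : Set
Pred = State → Bool

-- Extended non-negative reals [0,∞], as (open) lower Dedekind cuts:
-- a value r is represented by { q ∈ ℚ | q < r }  (all of ℚ for ∞).

record ℝ≥0∞ : Set₁ where
  field
    L       : ℚ → Set
    neg     : ∀ {q} → q < 0ℚ → L q
    down    : ∀ {q r} → r ≤ q → L q → L r
    rounded : ∀ {q} → L q → ∃[ r ] (q < r × L r)
open ℝ≥0∞ public

_≤∞_ : ℝ≥0∞ → ℝ≥0∞ → Set
x ≤∞ y = ∀ q → L x q → L y q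

private
  0<1 : 0ℚ < 1ℚ
  0<1 = toWitness {a? = 0ℚ <? 1ℚ} tt

  roundNeg : ∀ {q} → q < 0ℚ → ∃[ r ] (q < r × r < 0ℚ)
  roundNeg q<0 = <-dense q<0

0∞ : ℝ≥0∞
0∞ = record
  { L = λ q → q < 0ℚ
  ; neg = λ p → p
  ; down = λ r≤q q<0 → ≤-<-trans r≤q q<0
  ; rounded = λ q<0 → roundNeg q<0
  }

∞ : ℝ≥0∞
∞ = record
  { L = λ _ → ⊤
  ; neg = λ _ → tt
  ; down = λ _ _ → tt
  ; rounded = λ {q} _ → q + 1ℚ
              , subst (_< q + 1ℚ) (+-identityʳ q) (+-mono-≤-< (≤-refl {q}) 0<1) , tt
  }

_+∞_ : ℝ≥0∞ → ℝ≥0∞ → ℝ≥0∞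
x +∞ y = record
  { L = Lxy
  ; neg = inj₁
  ; down = dn
  ; rounded = rd
  }
  where
  Lxy : ℚ → Set
  Lxy q = q < 0ℚ ⊎ ∃[ a ] ∃[ b ] (L x a × L y b × q < a + b)
  dn : ∀ {q r} → r ≤ q → Lxy q → Lxy r
  dn r≤q (inj₁ q<0) = inj₁ (≤-<-trans r≤q q<0)
  dn r≤q (inj₂ (a , b , xa , yb , lt)) = inj₂ (a , b , xa , yb , ≤-<-trans r≤q lt)
  rd : ∀ {q} → Lxy q → ∃[ r ] (q < r × Lxy r)
  rd (inj₁ q<0) with roundNeg q<0
  ... | r , q<r , r<0 = r , q<r , inj₁ r<0
  rd (inj₂ (a , b , xa , yb , lt)) with <-dense lt
  ... | r , q<r , r<ab = r , q<r , inj₂ (a , b , xa , yb , r<ab)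

-- scaling by a non-negative quantity c given by its (lower) cut  Lc
-- (used for p · x and (1 - p) · x with p a probability); 0 · ∞ = 0.
scale : (ℚ → Set) → ℝ≥0∞ → ℝ≥0∞
scale Lc x = record
  { L = Ls
  ; neg = inj₁
  ; down = dn
  ; rounded = rd
  }
  where
  Ls : ℚ → Set
  Ls q = q < 0ℚ ⊎ ∃[ a ] ∃[ b ] (Lc a × 0ℚ ≤ a × L x b × 0ℚ ≤ b × q < a * b)
  dn : ∀ {q r} → r ≤ q → Ls q → Ls r
  dn r≤q (inj₁ q<0) = inj₁ (≤-<-trans r≤q q<0)
  dn r≤q (inj₂ (a , b , ca , a0 , xb , b0 , lt)) =
    inj₂ (a , b , ca , a0 , xb , b0 , ≤-<-trans r≤q lt)
  rd : ∀ {q} → Ls q → ∃[ r ] (q < r × Ls r)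
  rd (inj₁ q<0) with roundNeg q<0
  ... | r , q<r , r<0 = r , q<r , inj₁ r<0
  rd (inj₂ (a , b , ca , a0 , xb , b0 , lt)) with <-dense lt
  ... | r , q<r , r<ab = r , q<r , inj₂ (a , b , ca , a0 , xb , b0 , r<ab)

private
  <⊓ : ∀ {q r₁ r₂} → q < r₁ → q < r₂ → q < r₁ ⊓ r₂
  <⊓ {q} {r₁} {r₂} a b with r₁ ≤? r₂
  ... | yes r₁≤r₂ = subst (q <_) (sym (p≤q⇒p⊓q≡p r₁≤r₂)) a
  ... | no r₁≰r₂  = subst (q <_) (sym (p≥q⇒p⊓q≡q (<⇒≤ (≰⇒> r₁≰r₂)))) b

_⊓∞_ : ℝ≥0∞ → ℝ≥0∞ → ℝ≥0∞
x ⊓∞ y = record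
  { L = λ q → L x q × L y q
  ; neg = λ q<0 → neg x q<0 , neg y q<0
  ; down = λ r≤q (xq , yq) → down x r≤q xq , down y r≤q yq
  ; rounded = rd
  }
  where
  rd : ∀ {q} → L x q × L y q → ∃[ r ] (q < r × (L x r × L y r))
  rd (xq , yq) with rounded x xq | rounded y yq
  ... | r₁ , q<r₁ , xr₁ | r₂ , q<r₂ , yr₂ =
    r₁ ⊓ r₂ , <⊓ q<r₁ q<r₂ , down x (p⊓q≤p r₁ r₂) xr₁ , down y (p⊓q≤q r₁ r₂) yr₂

_⊔∞_ : ℝ≥0∞ → ℝ≥0∞ → ℝ≥0∞
x ⊔∞ y = record
  { L = λ q → L x q ⊎ L y q
  ; neg = λ q<0 → inj₁ (neg x q<0)
  ; down = λ { r≤q (inj₁ a) → inj₁ (down x r≤q a) ; r≤q (inj₂ b) → inj₂ (down y r≤q b) }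
  ; rounded = λ { (inj₁ a) → let (r , lt , xr) = rounded x a in r , lt , inj₁ xr
                ; (inj₂ b) → let (r , lt , yr) = rounded y b in r , lt , inj₂ yr }
  }

sup∞ : (ℕ → ℝ≥0∞) → ℝ≥0∞
sup∞ xs = record
  { L = λ q → ∃[ n ] L (xs n) q
  ; neg = λ q<0 → 0 , neg (xs 0) q<0
  ; down = λ { r≤q (n , h) → n , down (xs n) r≤q h }
  ; rounded = λ { (n , h) → let (r , lt , h') = rounded (xs n) h in r , lt , n , h' }
  }

-- Probabilities: Dedekind reals in [0,1]
--   lower = { q | q < p },  upper = { q | p < q }

record Prob : Set₁ where
  field
    lower upper   : ℚ → Set
    lower-down    : ∀ {q r} → r ≤ q → lower q → lower r
    upper-up      : ∀ {q r} → q ≤ r → upper q → upper r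
    lower-rounded : ∀ {q} → lower q → ∃[ r ] (q < r × lower r)
    upper-rounded : ∀ {q} → upper q → ∃[ r ] (r < q × upper r)
    disjoint      : ∀ {q} → lower q → upper q → ⊥
    located       : ∀ {q r} → q < r → lower q ⊎ upper r
    nonneg        : ∀ {q} → q < 0ℚ → lower q
    atmost1       : ∀ {q} → 1ℚ < q → upper q
open Prob public

_·ₚ_ : Prob → ℝ≥0∞ → ℝ≥0∞
p ·ₚ x = scale (lower p) x

_·ₚ̄_ : Prob → ℝ≥0∞ → ℝ≥0∞
p ·ₚ̄ x = scale (λ q → upper p (1ℚ - q)) x      -- q < 1 - p  ⇔  p < 1 - q

Exp : Set₁
Exp = State → ℝ≥0∞

_⪯_ : Exp → Exp → Set
f ⪯ g = ∀ σ → f σ ≤∞ g σ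

_⪰_ : Exp → Exp → Set
f ⪰ g = g ⪯ f

0ᴱ : Exp
0ᴱ _ = 0∞

[_]·_ : Pred → Exp → Exp
([ φ ]· f) σ = if φ σ then f σ else 0∞

_⇒ᴱ_ : Pred → Exp → Exp
(φ ⇒ᴱ g) σ = if φ σ then g σ else ∞

_+ᴱ_ : Exp → Exp → Exp
(f +ᴱ g) σ = f σ +∞ g σ

_⊓ᴱ_ : Exp → Exp → Exp
(f ⊓ᴱ g) σ = f σ ⊓∞ g σ

_⊔ᴱ_ : Exp → Exp → Exp
(f ⊔ᴱ g) σ = f σ ⊔∞ g σ

_[_/_] : Exp → Var → (State → ℚ≥0) → Exp
(f [ x / E ]) σ = f (update σ x (E σ))

data Prog : Set₁ where
  skip    : Prog
  _≔_     : Var → (State → ℚ≥0) → Prog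
  _⨾_     : Prog → Prog → Prog
  guarded : (φ₁ φ₂ : Pred) → (∀ σ → (φ₁ σ ∨ φ₂ σ) ≡ true) → Prog → Prog → Prog
  pchoice : (State → Prob) → Prog → Prog → Prog
  while   : (I : Exp) → (φ : Pred) → Prog → Prog

data Transformer : Set where
  dwp awp : Transformer

guardT : Transformer → Pred → Pred → Exp → Exp → Exp
guardT dwp φ₁ φ₂ a b = (φ₁ ⇒ᴱ a) ⊓ᴱ (φ₂ ⇒ᴱ b)
guardT awp φ₁ φ₂ a b = ([ φ₁ ]· a) ⊔ᴱ ([ φ₂ ]· b)

probT : (State → Prob) → Exp → Exp → Exp
probT p a b σ = (p σ ·ₚ a σ) +∞ (p σ ·ₚ̄ b σ)

iter : (Exp → Exp) → ℕ → Exp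
iter Φ zero    = 0ᴱ
iter Φ (suc n) = Φ (iter Φ n)

-- least fixed point of the (ω-continuous) loop characteristic function,
-- via Kleene iteration: lfp Φ = sup_n Φⁿ(0)
lfpᴱ : (Exp → Exp) → Exp
lfpᴱ Φ σ = sup∞ (λ n → iter Φ n σ)

⟦_⟧ : Transformer → Prog → Exp → Exp
⟦ t ⟧ skip f = f
⟦ t ⟧ (x ≔ E) f = f [ x / E ]
⟦ t ⟧ (C₁ ⨾ C₂) f = ⟦ t ⟧ C₁ (⟦ t ⟧ C₂ f)
⟦ t ⟧ (guarded φ₁ φ₂ _ C₁ C₂) f = guardT t φ₁ φ₂ (⟦ t ⟧ C₁ f) (⟦ t ⟧ C₂ f)
⟦ t ⟧ (pchoice p C₁ C₂) f = probT p (⟦ t ⟧ C₁ f) (⟦ t ⟧ C₂ f)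
⟦ t ⟧ (while I φ C) f = lfpᴱ (λ g → ([ (λ σ → not (φ σ)) ]· f) +ᴱ ([ φ ]· ⟦ t ⟧ C g))

⟦_⟧* : Transformer → Prog → Exp → Exp
⟦ t ⟧* skip f = f
⟦ t ⟧* (x ≔ E) f = f [ x / E ]
⟦ t ⟧* (C₁ ⨾ C₂) f = ⟦ t ⟧* C₁ (⟦ t ⟧* C₂ f)
⟦ t ⟧* (guarded φ₁ φ₂ _ C₁ C₂) f = guardT t φ₁ φ₂ (⟦ t ⟧* C₁ f) (⟦ t ⟧* C₂ f)
⟦ t ⟧* (pchoice p C₁ C₂) f = probT p (⟦ t ⟧* C₁ f) (⟦ t ⟧* C₂ f)
⟦ t ⟧* (while I φ C) f = I

VCProvider : Set₁
VCProvider = (I : Exp) → (φ : Pred) → (C' : Prog) → Exp → Bool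

vc : VCProvider → Transformer → Prog → Exp → Bool
vc 𝔠 t skip f = true
vc 𝔠 t (x ≔ E) f = true
vc 𝔠 t (C₁ ⨾ C₂) f = vc 𝔠 t C₁ (⟦ t ⟧* C₂ f) ∧ vc 𝔠 t C₂ f
vc 𝔠 t (guarded _ _ _ C₁ C₂) f = vc 𝔠 t C₁ f ∧ vc 𝔠 t C₂ f
vc 𝔠 t (pchoice _ C₁ C₂) f = vc 𝔠 t C₁ f ∧ vc 𝔠 t C₂ f
vc 𝔠 t (while I φ C) f = 𝔠 I φ C f ∧ vc 𝔠 t C I

YieldsUpperBounds : VCProvider → Transformer → Set₁
YieldsUpperBounds 𝔠 t = ∀ C f → vc 𝔠 t C f ≡ true → ⟦ t ⟧ C f ⪯ ⟦ t ⟧* C f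

YieldsLowerBounds : VCProvider → Transformer → Set₁
YieldsLowerBounds 𝔠 t = ∀ C f → vc 𝔠 t C f ≡ true → ⟦ t ⟧ C f ⪰ ⟦ t ⟧* C f

{-# OPTIONS --safe #-}
module Submission where

-- Every non-loop construct is monotone, and 𝒯 and 𝒯* differ only at loops, so the loop
-- hypothesis 𝒯⟦loop⟧ f ≲ I = 𝒯*⟦loop⟧ f propagates by induction on the program. The
-- only interesting case is C₁ ⨾ C₂: monotonicity of 𝒯⟦C₁⟧ transports 𝒯⟦C₂⟧ f ≲ 𝒯*⟦C₂⟧ f,
-- and the induction hypothesis for C₁ at the post-expectation 𝒯*⟦C₂⟧ f (the one vc uses)
-- finishes.

open import Defs
open import Data.Bool using (true; false; not)
open import Data.Bool.Properties using (∧-conicalˡ; ∧-conicalʳ)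
open import Data.Nat using (zero; suc)
open import Data.Product using (_×_; _,_)
open import Data.Rational using (ℚ; 1ℚ; _-_)
open import Data.Sum using (inj₁; inj₂)
open import Function using (flip)
open import Relation.Binary.PropositionalEquality using (_≡_)

-- f ⪯ g unfolds to an inclusion of lower cuts, from which unification cannot recover f
-- and g; wrapping it in a record keeps them visible.
record _≼_ (f g : Exp) : Set where
  constructor ⪯⇒≼
  field ≼⇒⪯ : f ⪯ g
open _≼_

≼-refl : ∀ {f} → f ≼ f
≼-refl = ⪯⇒≼ λ _ _ fq → fq

≼-trans : ∀ {f g h} → f ≼ g → g ≼ h → f ≼ h
≼-trans (⪯⇒≼ f⪯g) (⪯⇒≼ g⪯h) = ⪯⇒≼ λ σ q fq → g⪯h σ q (f⪯g σ q fq)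

+ᴱ-mono-≼ : ∀ {f f′ g g′} → f ≼ f′ → g ≼ g′ → (f +ᴱ g) ≼ (f′ +ᴱ g′)
+ᴱ-mono-≼ (⪯⇒≼ f⪯f′) (⪯⇒≼ g⪯g′) = ⪯⇒≼ λ where
  σ q (inj₁ q<0) → inj₁ q<0
  σ q (inj₂ (a , b , fa , gb , q<a+b)) → inj₂ (a , b , f⪯f′ σ a fa , g⪯g′ σ b gb , q<a+b)

scaleᴱ-mono-≼ : ∀ (c : State → ℚ → Set) {f f′} → f ≼ f′ →
                (λ σ → scale (c σ) (f σ)) ≼ (λ σ → scale (c σ) (f′ σ))
scaleᴱ-mono-≼ c (⪯⇒≼ f⪯f′) = ⪯⇒≼ λ where
  σ q (inj₁ q<0) → inj₁ q<0
  σ q (inj₂ (a , b , ca , a≥0 , fb , b≥0 , q<ab)) → inj₂ (a , b , ca , a≥0 , f⪯f′ σ b fb , b≥0 , q<ab)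

⊓ᴱ-mono-≼ : ∀ {f f′ g g′} → f ≼ f′ → g ≼ g′ → (f ⊓ᴱ g) ≼ (f′ ⊓ᴱ g′)
⊓ᴱ-mono-≼ (⪯⇒≼ f⪯f′) (⪯⇒≼ g⪯g′) = ⪯⇒≼ λ σ q (fq , gq) → f⪯f′ σ q fq , g⪯g′ σ q gq

⊔ᴱ-mono-≼ : ∀ {f f′ g g′} → f ≼ f′ → g ≼ g′ → (f ⊔ᴱ g) ≼ (f′ ⊔ᴱ g′)
⊔ᴱ-mono-≼ (⪯⇒≼ f⪯f′) (⪯⇒≼ g⪯g′) = ⪯⇒≼ λ where
  σ q (inj₁ fq) → inj₁ (f⪯f′ σ q fq)
  σ q (inj₂ gq) → inj₂ (g⪯g′ σ q gq)

[]·-mono-≼ : ∀ φ {f g} → f ≼ g → ([ φ ]· f) ≼ ([ φ ]· g)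
[]·-mono-≼ φ {f} {g} (⪯⇒≼ f⪯g) = ⪯⇒≼ [φ]·f⪯[φ]·g
  where
  [φ]·f⪯[φ]·g : ([ φ ]· f) ⪯ ([ φ ]· g)
  [φ]·f⪯[φ]·g σ with φ σ
  ... | true  = f⪯g σ
  ... | false = λ _ h → h

⇒ᴱ-mono-≼ : ∀ φ {f g} → f ≼ g → (φ ⇒ᴱ f) ≼ (φ ⇒ᴱ g)
⇒ᴱ-mono-≼ φ {f} {g} (⪯⇒≼ f⪯g) = ⪯⇒≼ φ⇒f⪯φ⇒g
  where
  φ⇒f⪯φ⇒g : (φ ⇒ᴱ f) ⪯ (φ ⇒ᴱ g)
  φ⇒f⪯φ⇒g σ with φ σ
  ... | true  = f⪯g σ
  ... | false = λ _ h → h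

lfpᴱ-mono-≼ : ∀ {Φ Ψ : Exp → Exp} → (∀ {g h} → g ≼ h → Φ g ≼ Ψ h) → lfpᴱ Φ ≼ lfpᴱ Ψ
lfpᴱ-mono-≼ {Φ} {Ψ} Φ≼Ψ = ⪯⇒≼ λ σ q (n , Φⁿq) → n , ≼⇒⪯ (iter-mono n) σ q Φⁿq
  where
  iter-mono : ∀ n → iter Φ n ≼ iter Ψ n
  iter-mono zero    = ⪯⇒≼ λ _ _ q<0 → q<0
  iter-mono (suc n) = Φ≼Ψ (iter-mono n)

guardT-mono-≼ : ∀ t φ₁ φ₂ {a a′ b b′} → a ≼ a′ → b ≼ b′ → guardT t φ₁ φ₂ a b ≼ guardT t φ₁ φ₂ a′ b′
guardT-mono-≼ dwp φ₁ φ₂ a≼a′ b≼b′ = ⊓ᴱ-mono-≼ (⇒ᴱ-mono-≼ φ₁ a≼a′) (⇒ᴱ-mono-≼ φ₂ b≼b′)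
guardT-mono-≼ awp φ₁ φ₂ a≼a′ b≼b′ = ⊔ᴱ-mono-≼ ([]·-mono-≼ φ₁ a≼a′) ([]·-mono-≼ φ₂ b≼b′)

probT-mono-≼ : ∀ p {a a′ b b′} → a ≼ a′ → b ≼ b′ → probT p a b ≼ probT p a′ b′
probT-mono-≼ p a≼a′ b≼b′ =
  +ᴱ-mono-≼ (scaleᴱ-mono-≼ (λ σ → lower (p σ)) a≼a′)
            (scaleᴱ-mono-≼ (λ σ q → upper (p σ) (1ℚ - q)) b≼b′)

⟦⟧-mono-≼ : ∀ t C {f g} → f ≼ g → ⟦ t ⟧ C f ≼ ⟦ t ⟧ C g
⟦⟧-mono-≼ t skip f≼g = f≼g
⟦⟧-mono-≼ t (x ≔ E) (⪯⇒≼ f⪯g) = ⪯⇒≼ λ σ → f⪯g (update σ x (E σ))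
⟦⟧-mono-≼ t (C₁ ⨾ C₂) f≼g = ⟦⟧-mono-≼ t C₁ (⟦⟧-mono-≼ t C₂ f≼g)
⟦⟧-mono-≼ t (guarded φ₁ φ₂ _ C₁ C₂) f≼g =
  guardT-mono-≼ t φ₁ φ₂ (⟦⟧-mono-≼ t C₁ f≼g) (⟦⟧-mono-≼ t C₂ f≼g)
⟦⟧-mono-≼ t (pchoice p C₁ C₂) f≼g =
  probT-mono-≼ p (⟦⟧-mono-≼ t C₁ f≼g) (⟦⟧-mono-≼ t C₂ f≼g)
⟦⟧-mono-≼ t (while I φ C) f≼g =
  lfpᴱ-mono-≼ λ g≼h → +ᴱ-mono-≼ ([]·-mono-≼ (λ σ → not (φ σ)) f≼g) ([]·-mono-≼ φ (⟦⟧-mono-≼ t C g≼h))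

module VCSoundness
  (t : Transformer)
  (_≲_ : Exp → Exp → Set)
  (≲-refl : ∀ {f} → f ≲ f)
  (≲-trans : ∀ {f g h} → f ≲ g → g ≲ h → f ≲ h)
  (⟦⟧-mono : ∀ C {f g} → f ≲ g → ⟦ t ⟧ C f ≲ ⟦ t ⟧ C g)
  (guardT-mono : ∀ φ₁ φ₂ {a a′ b b′} → a ≲ a′ → b ≲ b′ → guardT t φ₁ φ₂ a b ≲ guardT t φ₁ φ₂ a′ b′)
  (probT-mono : ∀ p {a a′ b b′} → a ≲ a′ → b ≲ b′ → probT p a b ≲ probT p a′ b′)
  (𝔠 : VCProvider)
  (loop-sound : ∀ I φ C′ f → vc 𝔠 t (while I φ C′) f ≡ true → ⟦ t ⟧ (while I φ C′) f ≲ I)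
  where

  vc-sound : ∀ C f → vc 𝔠 t C f ≡ true → ⟦ t ⟧ C f ≲ ⟦ t ⟧* C f
  vc-sound skip f _ = ≲-refl
  vc-sound (x ≔ E) f _ = ≲-refl
  vc-sound (C₁ ⨾ C₂) f vc≡true =
    ≲-trans (⟦⟧-mono C₁ (vc-sound C₂ f (∧-conicalʳ _ _ vc≡true)))
            (vc-sound C₁ (⟦ t ⟧* C₂ f) (∧-conicalˡ _ _ vc≡true))
  vc-sound (guarded φ₁ φ₂ _ C₁ C₂) f vc≡true =
    guardT-mono φ₁ φ₂ (vc-sound C₁ f (∧-conicalˡ _ _ vc≡true)) (vc-sound C₂ f (∧-conicalʳ _ _ vc≡true))
  vc-sound (pchoice p C₁ C₂) f vc≡true =
    probT-mono p (vc-sound C₁ f (∧-conicalˡ _ _ vc≡true)) (vc-sound C₂ f (∧-conicalʳ _ _ vc≡true))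
  vc-sound (while I φ C′) f vc≡true = loop-sound I φ C′ f vc≡true

module ≼-Soundness (t : Transformer) =
  VCSoundness t _≼_ ≼-refl ≼-trans (⟦⟧-mono-≼ t) (guardT-mono-≼ t) probT-mono-≼

module ≽-Soundness (t : Transformer) =
  VCSoundness t (flip _≼_) ≼-refl (flip ≼-trans)
    (λ C g≼f → ⟦⟧-mono-≼ t C g≼f)
    (λ φ₁ φ₂ a′≼a b′≼b → guardT-mono-≼ t φ₁ φ₂ a′≼a b′≼b)
    (λ p a′≼a b′≼b → probT-mono-≼ p a′≼a b′≼b)

lemmaB2 : (𝔠 : VCProvider) (t : Transformer) →
    ((∀ I φ C' f → vc 𝔠 t (while I φ C') f ≡ true → ⟦ t ⟧ (while I φ C') f ⪯ I) →
       YieldsUpperBounds 𝔠 t)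
    ×
    ((∀ I φ C' f → vc 𝔠 t (while I φ C') f ≡ true → ⟦ t ⟧ (while I φ C') f ⪰ I) →
       YieldsLowerBounds 𝔠 t)
lemmaB2 𝔠 t = yields-upper , yields-lower
  where
  yields-upper : (∀ I φ C′ f → vc 𝔠 t (while I φ C′) f ≡ true → ⟦ t ⟧ (while I φ C′) f ⪯ I) →
                 YieldsUpperBounds 𝔠 t
  yields-upper loop-sound C f vc≡true =
    ≼⇒⪯ (≼-Soundness.vc-sound t 𝔠 (λ I φ C′ f h → ⪯⇒≼ (loop-sound I φ C′ f h)) C f vc≡true)

  yields-lower : (∀ I φ C′ f → vc 𝔠 t (while I φ C′) f ≡ true → ⟦ t ⟧ (while I φ C′) f ⪰ I) →
                 YieldsLowerBounds 𝔠 t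
  yields-lower loop-sound C f vc≡true =
    ≼⇒⪯ (≽-Soundness.vc-sound t 𝔠 (λ I φ C′ f h → ⪯⇒≼ (loop-sound I φ C′ f h)) C f vc≡true)
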